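{- Let $\mathrm{GP}(8,3)$ be the Möbius–Kantor graph. Then $\mathrm{GP}(8,3)$ is a normal bi-Cayley graph over the quaternion group $\mathrm{Q}_8$: there is a subgroup $B\cong \mathrm{Q}_8$ of $\mathrm{Aut}(\mathrm{GP}(8,3))$ acting semiregularly on the vertex set with two orbits, and $B\trianglelefteq \mathrm{Aut}(\mathrm{GP}(8,3))$.
   Context: The Möbius–Kantor graph $\mathrm{GP}(8,3)$ has vertex set $\{i,i' : i\in\mathbb{Z}_8\}$ and edges $\{i,i+1\}$, $\{i',(i+3)'\}$ and $\{i,i'\}$ for $i\in\mathbb{Z}_8$. A permutation group is semiregular if all point stabilizers are trivial. -}

module Defs where

open import Data.Nat using (ℕ; _+_; _%_)
open import Data.Nat.DivMod using (m%n<n)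
open import Data.Fin using (Fin; toℕ; fromℕ<)
open import Data.Bool using (Bool; true; false; not; _xor_)
open import Data.Product using (_×_; _,_; Σ; ∃; ∃-syntax)
open import Data.Sum using (_⊎_)
open import Relation.Binary.PropositionalEquality using (_≡_)
open import Relation.Nullary using (¬_)
open import Function.Bundles using (_↔_; _⇔_; Inverse)

_+₈_ : Fin 8 → ℕ → Fin 8
i +₈ k = fromℕ< (m%n<n (toℕ i + k) 8)

data V : Set where
  out : Fin 8 → V
  inn : Fin 8 → V

data Edge : V → V → Set where
  outer : ∀ i → Edge (out i) (out (i +₈ 1))
  inner : ∀ i → Edge (inn i) (inn (i +₈ 3))
  spoke : ∀ i → Edge (out i) (inn i)

Adj : V → V → Set
Adj u v = Edge u v ⊎ Edge v u

record Aut : Set where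
  field
    perm     : V ↔ V
    preserve : ∀ u v → Adj u v ⇔ Adj (Inverse.to perm u) (Inverse.to perm v)

open Aut public

apply : Aut → V → V
apply σ = Inverse.to (perm σ)

applyInv : Aut → V → V
applyInv σ = Inverse.from (perm σ)

data Unit4 : Set where
  𝟙 𝕚 𝕛 𝕜 : Unit4

-- product of basis units: (sign flipped?, unit)
_·ᵤ_ : Unit4 → Unit4 → Bool × Unit4
𝟙 ·ᵤ u = false , u
u ·ᵤ 𝟙 = false , u
𝕚 ·ᵤ 𝕚 = true , 𝟙
𝕛 ·ᵤ 𝕛 = true , 𝟙
𝕜 ·ᵤ 𝕜 = true , 𝟙
𝕚 ·ᵤ 𝕛 = false , 𝕜
𝕛 ·ᵤ 𝕜 = false , 𝕚
𝕜 ·ᵤ 𝕚 = false , 𝕛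
𝕛 ·ᵤ 𝕚 = true , 𝕜
𝕜 ·ᵤ 𝕛 = true , 𝕚
𝕚 ·ᵤ 𝕜 = true , 𝕛

-- an element (s , u) stands for (-1)^s · u  (s = true means negative)
Q8 : Set
Q8 = Bool × Unit4

one : Q8
one = false , 𝟙

_·_ : Q8 → Q8 → Q8
(s , u) · (t , w) with u ·ᵤ w
... | (r , x) = ((s xor t) xor r) , x

-- A subgroup B ≅ Q8 of Aut(GP(8,3)), given as an injective
-- homomorphism φ : Q8 → Aut(GP(8,3)) (B = image of φ).

IsHom : (Q8 → Aut) → Set
IsHom φ = ∀ q r v → apply (φ (q · r)) v ≡ apply (φ q) (apply (φ r) v)

IsInjective : (Q8 → Aut) → Set
IsInjective φ = ∀ q r → (∀ v → apply (φ q) v ≡ apply (φ r) v) → q ≡ r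

Semiregular : (Q8 → Aut) → Set
Semiregular φ = ∀ q v → apply (φ q) v ≡ v → q ≡ one

TwoOrbits : (Q8 → Aut) → Set
TwoOrbits φ = Σ V λ v₀ → Σ V λ v₁ →
    (∀ v → (∃[ q ] v ≡ apply (φ q) v₀) ⊎ (∃[ q ] v ≡ apply (φ q) v₁))
  × ¬ (∃[ q ] apply (φ q) v₀ ≡ v₁)

Normal : (Q8 → Aut) → Set
Normal φ = ∀ (σ : Aut) (q : Q8) → ∃[ q' ] (∀ v → apply σ (apply (φ q) (applyInv σ v)) ≡ apply (φ q') v)

-- B is generated by the rotation i : k ↦ k + 2 of both rims and the twist
-- j : k ↦ (3k+1)′, k′ ↦ 3k+1 exchanging them; that these induce an injective
-- homomorphism Q8 → Aut acting semiregularly with two orbits is a finite check.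
--
-- For normality, call a permutation f of the vertices a quarter turn if every
-- v shares a neighbour with f v but not with f (f v).  This is invariant under
-- conjugation by automorphisms, and ±i, ±j, ±k are quarter turns.  Conversely,
-- since GP(8,3) is cubic without 4-cycles, an automorphism is determined by the
-- images of 0, 2 and 4 (all other images are forced as unique common or third
-- neighbours), and running through all candidate images shows that every
-- quarter turn lies in B.  So conjugation maps ±i, ±j, ±k into B, and −1 = i²
-- as well.
module Submission where

open import Defs
open import Data.Bool using (Bool; true; false; not)
import Data.Bool as Bool
open import Data.Empty using (⊥-elim)
open import Data.Fin using (Fin; toℕ; fromℕ<)
import Data.Fin as Fin
open import Data.Fin.Patterns
open import Data.List using (List; []; _∷_; map; _++_; allFin; cartesianProduct)
import Data.List.Relation.Unary.All as All
open import Data.List.Relation.Unary.Any using (here; there; satisfied; any?)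
open import Data.List.Membership.Propositional using (_∈_; lose)
open import Data.List.Membership.Propositional.Properties
  using (∈-map⁺; ∈-++⁺ˡ; ∈-++⁺ʳ; ∈-allFin; ∈-cartesianProduct⁺)
open import Data.Nat using (ℕ; _+_; _*_)
open import Data.Nat.DivMod using (m%n<n)
open import Data.Product using (Σ; _×_; _,_; proj₁; proj₂; ∃; ∃-syntax)
open import Data.Product.Properties using (≡-dec)
open import Data.Sum using (_⊎_)
open import Function using (_∘_)
open import Function.Bundles using (Inverse; Equivalence; mk↔ₛ′; mk⇔)
open import Relation.Binary.Definitions using (DecidableEquality)
open import Relation.Binary.PropositionalEquality
  using (_≡_; _≢_; refl; sym; trans; cong; subst; subst₂; module ≡-Reasoning)
open import Relation.Nullary using (¬_; Dec; yes; no)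
open import Relation.Nullary.Decidable using (map′; ¬?; _×-dec_; _⊎-dec_; _→-dec_; True; toWitness)
open import Relation.Unary using (Decidable)

module Exhaustive {A : Set} {xs : List A} (complete : ∀ a → a ∈ xs) where

  ∀? : {P : A → Set} → Decidable P → Dec (∀ a → P a)
  ∀? P? = map′ (λ all a → All.lookup all (complete a)) (λ ∀P → All.tabulate λ {a} _ → ∀P a)
               (All.all? P? xs)

  ∃? : {P : A → Set} → Decidable P → Dec (∃ P)
  ∃? P? = map′ satisfied (λ (a , p) → lose (complete a) p) (any? P? xs)

choose : {A : Set} {P : A → Set} → Dec (∃ P) → A → A
choose (yes (a , _)) _ = a
choose (no _)        d = d

choose-unique : {A : Set} {P : A → Set} {a d : A} → (∀ {b c} → P b → P c → b ≡ c) →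
                P a → (∃P? : Dec (∃ P)) → choose ∃P? d ≡ a
choose-unique unique pa (yes (b , pb)) = unique pb pa
choose-unique unique pa (no ¬∃P)       = ⊥-elim (¬∃P (_ , pa))

∈-vertices : ∀ v → v ∈ map out (allFin 8) ++ map inn (allFin 8)
∈-vertices (out i) = ∈-++⁺ˡ (∈-map⁺ out (∈-allFin i))
∈-vertices (inn i) = ∈-++⁺ʳ (map out (allFin 8)) (∈-map⁺ inn (∈-allFin i))

∈-quaternions : ∀ q → q ∈ cartesianProduct (false ∷ true ∷ []) (𝟙 ∷ 𝕚 ∷ 𝕛 ∷ 𝕜 ∷ [])
∈-quaternions (s , u) = ∈-cartesianProduct⁺ (∈-signs s) (∈-units u)
  where
  ∈-signs : ∀ s → s ∈ false ∷ true ∷ []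
  ∈-signs false = here refl
  ∈-signs true  = there (here refl)
  ∈-units : ∀ u → u ∈ 𝟙 ∷ 𝕚 ∷ 𝕛 ∷ 𝕜 ∷ []
  ∈-units 𝟙 = here refl
  ∈-units 𝕚 = there (here refl)
  ∈-units 𝕛 = there (there (here refl))
  ∈-units 𝕜 = there (there (there (here refl)))

open Exhaustive ∈-vertices    renaming (∀? to ∀ᵥ?; ∃? to ∃ᵥ?)
open Exhaustive ∈-quaternions renaming (∀? to ∀q?; ∃? to ∃q?)

infix 4 _≟ᵥ_ _≟ᵤ_ _≟q_

_≟ᵥ_ : DecidableEquality V
out i ≟ᵥ out j = map′ (cong out) (λ { refl → refl }) (i Fin.≟ j)
inn i ≟ᵥ inn j = map′ (cong inn) (λ { refl → refl }) (i Fin.≟ j)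
out _ ≟ᵥ inn _ = no λ ()
inn _ ≟ᵥ out _ = no λ ()

unitIndex : Unit4 → Fin 4
unitIndex 𝟙 = 0F
unitIndex 𝕚 = 1F
unitIndex 𝕛 = 2F
unitIndex 𝕜 = 3F

unitIndex-injective : ∀ {u w} → unitIndex u ≡ unitIndex w → u ≡ w
unitIndex-injective {𝟙} {𝟙} _ = refl
unitIndex-injective {𝕚} {𝕚} _ = refl
unitIndex-injective {𝕛} {𝕛} _ = refl
unitIndex-injective {𝕜} {𝕜} _ = refl

_≟ᵤ_ : DecidableEquality Unit4
u ≟ᵤ w = map′ unitIndex-injective (cong unitIndex) (unitIndex u Fin.≟ unitIndex w)

_≟q_ : DecidableEquality Q8
_≟q_ = ≡-dec Bool._≟_ _≟ᵤ_

outer-target : ∀ {i j} → Edge (out i) (out j) → j ≡ i +₈ 1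
outer-target (outer _) = refl

inner-target : ∀ {i j} → Edge (inn i) (inn j) → j ≡ i +₈ 3
inner-target (inner _) = refl

spoke-target : ∀ {i j} → Edge (out i) (inn j) → i ≡ j
spoke-target (spoke _) = refl

edge? : ∀ u v → Dec (Edge u v)
edge? (out i) (out j) = map′ (λ e → subst (Edge (out i) ∘ out) (sym e) (outer i)) outer-target (j Fin.≟ i +₈ 1)
edge? (inn i) (inn j) = map′ (λ e → subst (Edge (inn i) ∘ inn) (sym e) (inner i)) inner-target (j Fin.≟ i +₈ 3)
edge? (out i) (inn j) = map′ (λ e → subst (Edge (out i) ∘ inn) e (spoke i)) spoke-target (i Fin.≟ j)
edge? (inn _) (out _) = no λ ()

adj? : ∀ u v → Dec (Adj u v)
adj? u v = edge? u v ⊎-dec edge? v u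

adj : ∀ u v {_ : True (adj? u v)} → Adj u v
adj u v {uv} = toWitness uv

commonNeighbour-unique : ∀ {x y w w′} → x ≢ y → Adj x w → Adj y w → Adj x w′ → Adj y w′ → w ≡ w′
commonNeighbour-unique x≢y xw yw xw′ yw′ = toWitness {a? = check} _ _ _ xw _ yw _ xw′ yw′ x≢y
  where
  check : Dec (∀ x w → Adj x w → ∀ y → Adj y w → ∀ w′ → Adj x w′ → Adj y w′ → x ≢ y → w ≡ w′)
  check = ∀ᵥ? λ x → ∀ᵥ? λ w → adj? x w →-dec ∀ᵥ? λ y → adj? y w →-dec ∀ᵥ? λ w′ →
            adj? x w′ →-dec adj? y w′ →-dec ¬? (x ≟ᵥ y) →-dec w ≟ᵥ w′

thirdNeighbour-unique : ∀ {u x y w w′} → x ≢ y → Adj u x → Adj u y →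
                        Adj u w → w ≢ x → w ≢ y → Adj u w′ → w′ ≢ x → w′ ≢ y → w ≡ w′
thirdNeighbour-unique x≢y ux uy uw w≢x w≢y uw′ w′≢x w′≢y =
  toWitness {a? = check} _ _ _ ux _ uy x≢y _ uw w≢x w≢y _ uw′ w′≢x w′≢y
  where
  check : Dec (∀ u x → Adj u x → ∀ y → Adj u y → x ≢ y → ∀ w → Adj u w → w ≢ x → w ≢ y →
               ∀ w′ → Adj u w′ → w′ ≢ x → w′ ≢ y → w ≡ w′)
  check = ∀ᵥ? λ u → ∀ᵥ? λ x → adj? u x →-dec ∀ᵥ? λ y → adj? u y →-dec ¬? (x ≟ᵥ y) →-dec
            ∀ᵥ? λ w → adj? u w →-dec ¬? (w ≟ᵥ x) →-dec ¬? (w ≟ᵥ y) →-dec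
            ∀ᵥ? λ w′ → adj? u w′ →-dec ¬? (w′ ≟ᵥ x) →-dec ¬? (w′ ≟ᵥ y) →-dec w ≟ᵥ w′

-- Opaque so that unification never unfolds the underlying search on open terms.
opaque
  commonNeighbour : V → V → V
  commonNeighbour x y = choose (∃ᵥ? λ w → adj? x w ×-dec adj? y w) x

  thirdNeighbour : V → V → V → V
  thirdNeighbour u x y = choose (∃ᵥ? λ w → adj? u w ×-dec ¬? (w ≟ᵥ x) ×-dec ¬? (w ≟ᵥ y)) u

  commonNeighbour-spec : ∀ {x y w} → x ≢ y → Adj x w → Adj y w → commonNeighbour x y ≡ w
  commonNeighbour-spec {x} {y} x≢y xw yw =
    choose-unique (λ (xb , yb) (xc , yc) → commonNeighbour-unique x≢y xb yb xc yc) (xw , yw)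
                  (∃ᵥ? λ w → adj? x w ×-dec adj? y w)

  thirdNeighbour-spec : ∀ {u x y w} → x ≢ y → Adj u x → Adj u y → Adj u w → w ≢ x → w ≢ y →
                        thirdNeighbour u x y ≡ w
  thirdNeighbour-spec {u} {x} {y} x≢y ux uy uw w≢x w≢y =
    choose-unique (λ (ub , b≢x , b≢y) (uc , c≢x , c≢y) →
                     thirdNeighbour-unique x≢y ux uy ub b≢x b≢y uc c≢x c≢y)
                  (uw , w≢x , w≢y)
                  (∃ᵥ? λ w → adj? u w ×-dec ¬? (w ≟ᵥ x) ×-dec ¬? (w ≟ᵥ y))

record IsEmbedding (f : V → V) : Set where
  field
    preserves : ∀ {u v} → Adj u v → Adj (f u) (f v)
    injective : ∀ {u v} → f u ≡ f v → u ≡ v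

  preserves-≢ : ∀ {u v} → u ≢ v → f u ≢ f v
  preserves-≢ u≢v = u≢v ∘ injective

  via-commonNeighbour : ∀ {x y w a b} → x ≢ y → Adj x w → Adj y w → f x ≡ a → f y ≡ b →
                        f w ≡ commonNeighbour a b
  via-commonNeighbour x≢y xw yw refl refl =
    sym (commonNeighbour-spec (preserves-≢ x≢y) (preserves xw) (preserves yw))

  via-thirdNeighbour : ∀ {u x y w c a b} → x ≢ y → Adj u x → Adj u y → Adj u w → w ≢ x → w ≢ y →
                       f u ≡ c → f x ≡ a → f y ≡ b → f w ≡ thirdNeighbour c a b
  via-thirdNeighbour x≢y ux uy uw w≢x w≢y refl refl refl =
    sym (thirdNeighbour-spec (preserves-≢ x≢y) (preserves ux) (preserves uy) (preserves uw)
                             (preserves-≢ w≢x) (preserves-≢ w≢y))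

∘-embedding : ∀ {f g} → IsEmbedding f → IsEmbedding g → IsEmbedding (f ∘ g)
∘-embedding f-emb g-emb = record
  { preserves = F.preserves ∘ G.preserves
  ; injective = G.injective ∘ F.injective
  }
  where module F = IsEmbedding f-emb
        module G = IsEmbedding g-emb

reconstruct : V → V → V → V → V
reconstruct a₀ a₂ a₄ = λ where
    (out 0F) → a₀ ; (out 1F) → a₁ ; (out 2F) → a₂ ; (out 3F) → a₃
    (out 4F) → a₄ ; (out 5F) → a₅ ; (out 6F) → a₆ ; (out 7F) → a₇
    (inn 0F) → b₀ ; (inn 1F) → b₁ ; (inn 2F) → b₂ ; (inn 3F) → b₃
    (inn 4F) → b₄ ; (inn 5F) → b₅ ; (inn 6F) → b₆ ; (inn 7F) → b₇
  where
  a₁ a₃ b₁ b₂ b₃ b₀ b₄ b₆ b₇ a₇ a₅ b₅ a₆ : V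
  a₁ = commonNeighbour a₀ a₂
  a₃ = commonNeighbour a₂ a₄
  b₁ = thirdNeighbour a₁ a₀ a₂
  b₂ = thirdNeighbour a₂ a₁ a₃
  b₃ = thirdNeighbour a₃ a₂ a₄
  b₀ = commonNeighbour a₀ b₃
  b₄ = commonNeighbour a₄ b₁
  b₆ = commonNeighbour b₁ b₃
  b₇ = commonNeighbour b₂ b₄
  a₇ = thirdNeighbour a₀ a₁ b₀
  a₅ = thirdNeighbour a₄ a₃ b₄
  b₅ = thirdNeighbour b₂ a₂ b₇
  a₆ = thirdNeighbour b₆ b₁ b₃

reconstruct-correct : ∀ {f} → IsEmbedding f →
                      ∀ v → f v ≡ reconstruct (f (out 0F)) (f (out 2F)) (f (out 4F)) v
reconstruct-correct {f} emb = λ where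
    (out 0F) → e₀ ; (out 1F) → e₁ ; (out 2F) → e₂ ; (out 3F) → e₃
    (out 4F) → e₄ ; (out 5F) → e₅ ; (out 6F) → e₆ ; (out 7F) → e₇
    (inn 0F) → e₀′ ; (inn 1F) → e₁′ ; (inn 2F) → e₂′ ; (inn 3F) → e₃′
    (inn 4F) → e₄′ ; (inn 5F) → e₅′ ; (inn 6F) → e₆′ ; (inn 7F) → e₇′
  where
  open IsEmbedding emb
  Correct : V → Set
  Correct v = f v ≡ reconstruct (f (out 0F)) (f (out 2F)) (f (out 4F)) v
  e₀ : Correct (out 0F)
  e₀ = refl
  e₂ : Correct (out 2F)
  e₂ = refl
  e₄ : Correct (out 4F)
  e₄ = refl
  e₁ : Correct (out 1F)
  e₁ = via-commonNeighbour (λ ()) (adj _ _) (adj _ _) e₀ e₂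
  e₃ : Correct (out 3F)
  e₃ = via-commonNeighbour (λ ()) (adj _ _) (adj _ _) e₂ e₄
  e₁′ : Correct (inn 1F)
  e₁′ = via-thirdNeighbour (λ ()) (adj _ _) (adj _ _) (adj _ _) (λ ()) (λ ()) e₁ e₀ e₂
  e₂′ : Correct (inn 2F)
  e₂′ = via-thirdNeighbour (λ ()) (adj _ _) (adj _ _) (adj _ _) (λ ()) (λ ()) e₂ e₁ e₃
  e₃′ : Correct (inn 3F)
  e₃′ = via-thirdNeighbour (λ ()) (adj _ _) (adj _ _) (adj _ _) (λ ()) (λ ()) e₃ e₂ e₄
  e₀′ : Correct (inn 0F)
  e₀′ = via-commonNeighbour (λ ()) (adj _ _) (adj _ _) e₀ e₃′
  e₄′ : Correct (inn 4F)
  e₄′ = via-commonNeighbour (λ ()) (adj _ _) (adj _ _) e₄ e₁′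
  e₆′ : Correct (inn 6F)
  e₆′ = via-commonNeighbour (λ ()) (adj _ _) (adj _ _) e₁′ e₃′
  e₇′ : Correct (inn 7F)
  e₇′ = via-commonNeighbour (λ ()) (adj _ _) (adj _ _) e₂′ e₄′
  e₇ : Correct (out 7F)
  e₇ = via-thirdNeighbour (λ ()) (adj _ _) (adj _ _) (adj _ _) (λ ()) (λ ()) e₀ e₁ e₀′
  e₅ : Correct (out 5F)
  e₅ = via-thirdNeighbour (λ ()) (adj _ _) (adj _ _) (adj _ _) (λ ()) (λ ()) e₄ e₃ e₄′
  e₅′ : Correct (inn 5F)
  e₅′ = via-thirdNeighbour (λ ()) (adj _ _) (adj _ _) (adj _ _) (λ ()) (λ ()) e₂′ e₂ e₇′
  e₆ : Correct (out 6F)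
  e₆ = via-thirdNeighbour (λ ()) (adj _ _) (adj _ _) (adj _ _) (λ ()) (λ ()) e₆′ e₁′ e₃′

Near : V → V → Set
Near u v = ∃[ w ] Adj u w × Adj w v

near? : ∀ u v → Dec (Near u v)
near? u v = ∃ᵥ? λ w → adj? u w ×-dec adj? w v

Near-preserved : ∀ {f u v} → IsEmbedding f → Near u v → Near (f u) (f v)
Near-preserved emb (w , uw , wv) = _ , preserves uw , preserves wv
  where open IsEmbedding emb

IsQuarterTurn : (V → V) → Set
IsQuarterTurn f = ∀ v → Near v (f v) × ¬ Near v (f (f v))

quarterTurn? : ∀ f → Dec (IsQuarterTurn f)
quarterTurn? f = ∀ᵥ? λ v → near? v (f v) ×-dec ¬? (near? v (f (f v)))

quarterTurn-resp : ∀ {f g} → (∀ v → f v ≡ g v) → IsQuarterTurn f → IsQuarterTurn g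
quarterTurn-resp {f} {g} f≗g qt v =
    subst (Near v) (f≗g v) (proj₁ (qt v))
  , proj₂ (qt v) ∘ subst (Near v) (sym (trans (f≗g (f v)) (cong g (f≗g v))))

ℤ₈ : ℕ → Fin 8
ℤ₈ n = fromℕ< (m%n<n n 8)

rotate : ℕ → V → V
rotate m (out k) = out (k +₈ m)
rotate m (inn k) = inn (k +₈ m)

twist : V → V
twist (out k) = inn (ℤ₈ (3 * toℕ k + 1))
twist (inn k) = out (ℤ₈ (3 * toℕ k + 1))

halfTurns : Bool → ℕ
halfTurns false = 0
halfTurns true  = 4

Φ : Q8 → V → V
Φ (s , 𝟙) = rotate (halfTurns s)
Φ (s , 𝕚) = rotate (2 + halfTurns s)
Φ (s , 𝕛) = rotate (halfTurns s) ∘ twist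
Φ (s , 𝕜) = rotate (2 + halfTurns s) ∘ twist

InB : (V → V) → Set
InB f = ∃[ q ] ∀ v → f v ≡ Φ q v

Φ-hom : ∀ q r v → Φ (q · r) v ≡ Φ q (Φ r v)
Φ-hom = toWitness {a? = ∀q? λ q → ∀q? λ r → ∀ᵥ? λ v → Φ (q · r) v ≟ᵥ Φ q (Φ r v)} _

Φ-one : ∀ v → Φ one v ≡ v
Φ-one = toWitness {a? = ∀ᵥ? λ v → Φ one v ≟ᵥ v} _

Φ-preserves : ∀ q {u v} → Adj u v → Adj (Φ q u) (Φ q v)
Φ-preserves q {u} {v} =
  toWitness {a? = ∀q? λ q → ∀ᵥ? λ u → ∀ᵥ? λ v → adj? u v →-dec adj? (Φ q u) (Φ q v)} _ q u v

infix 30 _⁻¹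

_⁻¹ : Q8 → Q8
(s , 𝟙) ⁻¹ = s , 𝟙
(s , u) ⁻¹ = not s , u

·-inverseʳ : ∀ q → q · q ⁻¹ ≡ one
·-inverseʳ = toWitness {a? = ∀q? λ q → q · q ⁻¹ ≟q one} _

·-inverseˡ : ∀ q → q ⁻¹ · q ≡ one
·-inverseˡ = toWitness {a? = ∀q? λ q → q ⁻¹ · q ≟q one} _

Φ-cancel : ∀ q r → q · r ≡ one → ∀ v → Φ q (Φ r v) ≡ v
Φ-cancel q r qr≡one v = begin
  Φ q (Φ r v)  ≡⟨ Φ-hom q r v ⟨
  Φ (q · r) v  ≡⟨ cong (λ p → Φ p v) qr≡one ⟩
  Φ one v      ≡⟨ Φ-one v ⟩
  v            ∎
  where open ≡-Reasoning

mkAut : (f g : V → V) → (∀ v → f (g v) ≡ v) → (∀ v → g (f v) ≡ v) →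
        (∀ {u v} → Adj u v → Adj (f u) (f v)) → (∀ {u v} → Adj u v → Adj (g u) (g v)) → Aut
mkAut f g fg gf f-adj g-adj = record
  { perm     = mk↔ₛ′ f g fg gf
  ; preserve = λ u v → mk⇔ f-adj (subst₂ Adj (gf u) (gf v) ∘ g-adj)
  }

φ : Q8 → Aut
φ q = mkAut (Φ q) (Φ (q ⁻¹)) (Φ-cancel q (q ⁻¹) (·-inverseʳ q)) (Φ-cancel (q ⁻¹) q (·-inverseˡ q))
            (Φ-preserves q) (Φ-preserves (q ⁻¹))

Φ-semiregular : ∀ q v → Φ q v ≡ v → q ≡ one
Φ-semiregular = toWitness {a? = ∀q? λ q → ∀ᵥ? λ v → Φ q v ≟ᵥ v →-dec q ≟q one} _

Φ-injective-at-0 : ∀ q r → Φ q (out 0F) ≡ Φ r (out 0F) → q ≡ r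
Φ-injective-at-0 = toWitness {a? = ∀q? λ q → ∀q? λ r → Φ q (out 0F) ≟ᵥ Φ r (out 0F) →-dec q ≟q r} _

Φ-orbits : ∀ v → (∃[ q ] v ≡ Φ q (out 0F)) ⊎ (∃[ q ] v ≡ Φ q (inn 0F))
Φ-orbits = toWitness {a? = ∀ᵥ? λ v → (∃q? λ q → v ≟ᵥ Φ q (out 0F)) ⊎-dec (∃q? λ q → v ≟ᵥ Φ q (inn 0F))}
             _

Φ-orbits-distinct : ¬ (∃[ q ] Φ q (out 0F) ≡ inn 0F)
Φ-orbits-distinct = toWitness {a? = ¬? (∃q? λ q → Φ q (out 0F) ≟ᵥ inn 0F)} _

Φ-quarterTurn : ∀ q → proj₂ q ≢ 𝟙 → IsQuarterTurn (Φ q)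
Φ-quarterTurn = toWitness {a? = ∀q? λ q → ¬? (proj₂ q ≟ᵤ 𝟙) →-dec quarterTurn? (Φ q)} _

opaque
  unfolding commonNeighbour thirdNeighbour

  -- The Near hypotheses are implied by the quarter-turn one; they only prune the search.
  reconstruct-quarterTurn : ∀ a₀ a₂ a₄ → IsQuarterTurn (reconstruct a₀ a₂ a₄) →
                            InB (reconstruct a₀ a₂ a₄)
  reconstruct-quarterTurn a₀ a₂ a₄ qt =
    toWitness {a? = check} _ a₀ (proj₁ (qt (out 0F))) a₂ (proj₁ (qt (out 2F))) a₄ (proj₁ (qt (out 4F))) qt
    where
    check : Dec (∀ a₀ → Near (out 0F) a₀ → ∀ a₂ → Near (out 2F) a₂ → ∀ a₄ → Near (out 4F) a₄ →
                 IsQuarterTurn (reconstruct a₀ a₂ a₄) → InB (reconstruct a₀ a₂ a₄))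
    check = ∀ᵥ? λ a₀ → near? (out 0F) a₀ →-dec ∀ᵥ? λ a₂ → near? (out 2F) a₂ →-dec
              ∀ᵥ? λ a₄ → near? (out 4F) a₄ →-dec quarterTurn? (reconstruct a₀ a₂ a₄) →-dec
              ∃q? λ q → ∀ᵥ? λ v → reconstruct a₀ a₂ a₄ v ≟ᵥ Φ q v

quarterTurn⇒InB : ∀ {f} → IsEmbedding f → IsQuarterTurn f → InB f
quarterTurn⇒InB emb qt with reconstruct-quarterTurn _ _ _ (quarterTurn-resp (reconstruct-correct emb) qt)
... | q , reconstruct≗Φq = q , λ v → trans (reconstruct-correct emb v) (reconstruct≗Φq v)

apply-embedding : (σ : Aut) → IsEmbedding (apply σ)
apply-embedding σ = record
  { preserves = Equivalence.to (preserve σ _ _)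
  ; injective = λ {u} {v} e →
      trans (sym (strictlyInverseʳ u)) (trans (cong (applyInv σ) e) (strictlyInverseʳ v))
  }
  where open Inverse (perm σ)

applyInv-embedding : (σ : Aut) → IsEmbedding (applyInv σ)
applyInv-embedding σ = record
  { preserves = λ {u} {v} uv → Equivalence.from (preserve σ _ _)
      (subst₂ Adj (sym (strictlyInverseˡ u)) (sym (strictlyInverseˡ v)) uv)
  ; injective = λ {u} {v} e →
      trans (sym (strictlyInverseˡ u)) (trans (cong (apply σ) e) (strictlyInverseˡ v))
  }
  where open Inverse (perm σ)

module _ (σ : Aut) where
  open Inverse (perm σ) using (strictlyInverseˡ; strictlyInverseʳ)

  conjugate : (V → V) → V → V
  conjugate g = apply σ ∘ g ∘ applyInv σ

  conjugate-embedding : ∀ {g} → IsEmbedding g → IsEmbedding (conjugate g)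
  conjugate-embedding g-emb = ∘-embedding (apply-embedding σ) (∘-embedding g-emb (applyInv-embedding σ))

  conjugate-quarterTurn : ∀ {g} → IsQuarterTurn g → IsQuarterTurn (conjugate g)
  conjugate-quarterTurn {g} qt v = near , ¬near
    where
    u = applyInv σ v
    near : Near v (conjugate g v)
    near = subst (λ x → Near x (apply σ (g u))) (strictlyInverseˡ v)
                 (Near-preserved (apply-embedding σ) (proj₁ (qt u)))
    ¬near : ¬ Near v (conjugate g (conjugate g v))
    ¬near n = proj₂ (qt u) (subst (Near u ∘ g) (strictlyInverseʳ (g u))
                             (subst (Near u) (strictlyInverseʳ _) (Near-preserved (applyInv-embedding σ) n)))

  conjugate-· : ∀ q r → InB (conjugate (Φ q)) → InB (conjugate (Φ r)) → InB (conjugate (Φ (q · r)))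
  conjugate-· q r (q′ , eq) (r′ , er) = q′ · r′ , λ v → begin
    apply σ (Φ (q · r) (applyInv σ v))    ≡⟨ cong (apply σ) (Φ-hom q r _) ⟩
    apply σ (Φ q (Φ r (applyInv σ v)))    ≡⟨ cong (apply σ ∘ Φ q) (strictlyInverseʳ _) ⟨
    conjugate (Φ q) (conjugate (Φ r) v)  ≡⟨ eq _ ⟩
    Φ q′ (conjugate (Φ r) v)             ≡⟨ cong (Φ q′) (er v) ⟩
    Φ q′ (Φ r′ v)                        ≡⟨ Φ-hom q′ r′ v ⟨
    Φ (q′ · r′) v                        ∎
    where open ≡-Reasoning

  conjugate-quarterTurn-Φ : ∀ q → proj₂ q ≢ 𝟙 → InB (conjugate (Φ q))
  conjugate-quarterTurn-Φ q u≢𝟙 =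
    quarterTurn⇒InB (conjugate-embedding (apply-embedding (φ q)))
                    (conjugate-quarterTurn (Φ-quarterTurn q u≢𝟙))

  conjugate-Φ : ∀ q → InB (conjugate (Φ q))
  conjugate-Φ (false , 𝟙) =
    one , λ v → trans (cong (apply σ) (Φ-one _)) (trans (strictlyInverseˡ v) (sym (Φ-one v)))
  conjugate-Φ (true , 𝟙) =
    conjugate-· (false , 𝕚) (false , 𝕚) (conjugate-Φ (false , 𝕚)) (conjugate-Φ (false , 𝕚))
  conjugate-Φ q@(_ , 𝕚) = conjugate-quarterTurn-Φ q λ ()
  conjugate-Φ q@(_ , 𝕛) = conjugate-quarterTurn-Φ q λ ()
  conjugate-Φ q@(_ , 𝕜) = conjugate-quarterTurn-Φ q λ ()

lemma3p2 : Σ (Q8 → Aut) λ φ → IsHom φ × IsInjective φ × Semiregular φ × TwoOrbits φ × Normal φ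
lemma3p2 =
    φ
  , Φ-hom
  , (λ q r φq≗φr → Φ-injective-at-0 q r (φq≗φr (out 0F)))
  , Φ-semiregular
  , (out 0F , inn 0F , Φ-orbits , Φ-orbits-distinct)
  , conjugate-Φ
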